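{- Let $m>2$ be an integer, $n=3m$, and let $a,b,c$ be integers with $a\not\equiv 0$, $b\not\equiv 0$, $c\not\equiv 0\pmod 3$. If $a\not\equiv b\pmod 3$ or $b\not\equiv c\pmod 3$ or $c\not\equiv a\pmod 3$, then the $n$-tuple $(a,b,c,\,a,b,c,\,\ldots,\,a,b,c)$ (block $(a,b,c)$ repeated $m$ times) does not represent an $m$-circular $3m$-polygon.
   Context: Let $V_n=\{v_k=e^{2\pi i k/n}: k=0,\dots,n-1\}\subset\mathbb{C}$. An $n$-polygon is a closed polygonal path visiting every point of $V_n$ exactly once (a Hamiltonian cycle on $V_n$ drawn with straight segments). An $n$-tuple $(e_1,\dots,e_n)$ with entries in $\{1,\dots,n-1\}$ represents the path starting at $v_0$ and moving successively to $v_{s_1},\dots,v_{s_n}$, where $s_k=e_1+\dots+e_k$ (indices mod $n$); it represents an $n$-polygon iff $n\nmid s_k$ for $1\le k\le n-1$ and $n\mid s_n$. A symmetry axis of an $n$-polygon is a line through $0$ such that reflection in it maps the polygon onto itself. An $m$-circular $3m$-polygon is a $3m$-polygon with no symmetry axis that is mapped onto itself by the rotations about $0$ through the angles $\frac{3\cdot 2\pi i}{n}$, $i=1,\dots,m$. -}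

module Defs where

open import Data.Nat using (ℕ; zero; suc)
open import Data.Integer using (ℤ; +_; _+_; _-_; _*_; _≤_)
open import Data.Integer.Divisibility using (_∣_)
open import Data.Product using (Σ; _×_; ∃; _,_)
open import Data.Sum using (_⊎_)
open import Relation.Nullary using (¬_)
open import Function.Bundles using (_⇔_)

_≡[_]_ : ℤ → ℕ → ℤ → Set
x ≡[ n ] y = + n ∣ (x - y)

-- An n-tuple is given as a function e : ℕ → ℤ, with entries e 1, …, e n
-- (values at other indices are irrelevant).

psum : (ℕ → ℤ) → ℕ → ℤ
psum e zero = + 0
psum e (suc k) = psum e k + e (suc k)

Represents : ℕ → (ℕ → ℤ) → Set
Represents n e =
  (∀ k → 1 Data.Nat.≤ k → k Data.Nat.≤ n → (+ 1 ≤ e k) × (e k ≤ + n - + 1))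
  × (∀ k → 1 Data.Nat.≤ k → k Data.Nat.≤ n Data.Nat.∸ 1 → ¬ (+ n ∣ psum e k))
  × (+ n ∣ psum e n)

-- vertex v_x (x taken mod n) and vertex v_y are joined by a side of the
-- polygon traced by e: the k-th side joins v_{s_k} and v_{s_{k+1}}, 0 ≤ k < n
Side : ℕ → (ℕ → ℤ) → ℤ → ℤ → Set
Side n e x y = ∃ λ k → (k Data.Nat.< n) ×
  (((x ≡[ n ] psum e k) × (y ≡[ n ] psum e (suc k)))
   ⊎ ((x ≡[ n ] psum e (suc k)) × (y ≡[ n ] psum e k)))

Preserves : ℕ → (ℕ → ℤ) → (ℤ → ℤ) → Set
Preserves n e f = ∀ x y → Side n e x y ⇔ Side n e (f x) (f y)

-- the polygon has a symmetry axis: the reflections in lines through 0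
-- mapping V_n onto itself are exactly v_k ↦ v_{j-k}, j ∈ ℤ
HasSymmetryAxis : ℕ → (ℕ → ℤ) → Set
HasSymmetryAxis n e = ∃ λ j → Preserves n e (λ x → j - x)

-- e represents an m-circular 3m-polygon: the rotation through
-- 3·2π i/n maps v_k ↦ v_{k+3i}
RepresentsCircular : ℕ → (ℕ → ℤ) → Set
RepresentsCircular m e =
  Represents (3 Data.Nat.* m) e
  × ¬ HasSymmetryAxis (3 Data.Nat.* m) e
  × (∀ i → 1 Data.Nat.≤ i → i Data.Nat.≤ m →
       Preserves (3 Data.Nat.* m) e (λ x → x + + (3 Data.Nat.* i)))

abcTuple : ℤ → ℤ → ℤ → ℕ → ℤ
abcTuple a b c zero = c
abcTuple a b c (suc zero) = a
abcTuple a b c (suc (suc zero)) = b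
abcTuple a b c (suc (suc (suc k))) = abcTuple a b c k

-- A tuple with period (a, b, c) closes up after 3m steps only if 3m divides
-- m (a + b + c), i.e. only if 3 divides a + b + c. Residues prime to 3 are ±1,
-- and three of them can sum to 0 mod 3 only when they are all equal.
module Submission where

open import Defs
open import Data.Nat using (ℕ; _<_)
open import Data.Integer using (ℤ; +_; _-_)
open import Data.Integer.Divisibility using (_∣_)
open import Data.Sum using (_⊎_)
open import Relation.Nullary using (¬_)

open import Data.Nat as ℕ using (zero; suc; s≤s; NonZero; >-nonZero)
import Data.Nat.Properties as ℕ
open import Data.Integer using (_+_; _*_)
open import Data.Integer.Properties using (+-identityˡ; pos-*)
open import Data.Integer.DivMod using (_%_; _/_; n%d<d; a≡a%n+[a/n]*n)
open import Data.Integer.Divisibility using (*-cancelˡ-∣)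
open import Data.Integer.Divisibility.Signed
  using (divides; ∣-trans; ∣-reflexive; ∣ᵤ⇒∣; ∣⇒∣ᵤ; ∣m∣n⇒∣m+n; ∣m∣n⇒∣m-n; ∣m+n∣m⇒∣n)
  renaming (_∣_ to _∣ˢ_)
open import Data.Integer.Tactic.RingSolver using (solve)
open import Data.List using ([]; _∷_)
open import Data.Product using (_,_)
open import Data.Sum using (inj₁; inj₂; [_,_])
open import Data.Empty using (⊥-elim)
open import Function using (_$_; _∘_)
open import Relation.Binary.PropositionalEquality using (_≡_; refl; trans; cong; subst; subst₂; module ≡-Reasoning)

open ≡-Reasoning

3∤x⇒3∣x-1⊎3∣x+1 : ∀ x → ¬ (+ 3 ∣ˢ x) → (+ 3 ∣ˢ x - + 1) ⊎ (+ 3 ∣ˢ x + + 1)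
3∤x⇒3∣x-1⊎3∣x+1 x 3∤x with x % + 3 | x / + 3 | n%d<d x (+ 3) | a≡a%n+[a/n]*n x (+ 3)
... | 0 | q | _ | x≡ = ⊥-elim (3∤x (divides q (trans x≡ (+-identityˡ _))))
... | 1 | q | _ | x≡ = inj₁ (divides q (begin
  x - + 1              ≡⟨ cong (_- + 1) x≡ ⟩
  + 1 + q * + 3 - + 1  ≡⟨ solve (q ∷ []) ⟩
  q * + 3              ∎))
... | 2 | q | _ | x≡ = inj₂ (divides (q + + 1) (begin
  x + + 1              ≡⟨ cong (_+ + 1) x≡ ⟩
  + 2 + q * + 3 + + 1  ≡⟨ solve (q ∷ []) ⟩
  (q + + 1) * + 3      ∎))
... | suc (suc (suc _)) | _ | s≤s (s≤s (s≤s ())) | _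

3∤x⇒3∤y⇒3∣x-y⊎3∣x+y : ∀ {x y} → ¬ (+ 3 ∣ˢ x) → ¬ (+ 3 ∣ˢ y) →
                       (+ 3 ∣ˢ x - y) ⊎ (+ 3 ∣ˢ x + y)
3∤x⇒3∤y⇒3∣x-y⊎3∣x+y {x} {y} 3∤x 3∤y with 3∤x⇒3∣x-1⊎3∣x+1 x 3∤x | 3∤x⇒3∣x-1⊎3∣x+1 y 3∤y
... | inj₁ x≡1  | inj₁ y≡1  = inj₁ (∣-trans (∣m∣n⇒∣m-n x≡1 y≡1) (∣-reflexive (solve (x ∷ y ∷ []))))
... | inj₂ x≡-1 | inj₂ y≡-1 = inj₁ (∣-trans (∣m∣n⇒∣m-n x≡-1 y≡-1) (∣-reflexive (solve (x ∷ y ∷ []))))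
... | inj₁ x≡1  | inj₂ y≡-1 = inj₂ (∣-trans (∣m∣n⇒∣m+n x≡1 y≡-1) (∣-reflexive (solve (x ∷ y ∷ []))))
... | inj₂ x≡-1 | inj₁ y≡1  = inj₂ (∣-trans (∣m∣n⇒∣m+n x≡-1 y≡1) (∣-reflexive (solve (x ∷ y ∷ []))))

3∣x+y+z⇒3∣x-y : ∀ x y z → ¬ (+ 3 ∣ x) → ¬ (+ 3 ∣ y) → ¬ (+ 3 ∣ z) →
                                     + 3 ∣ x + y + z → + 3 ∣ x - y
3∣x+y+z⇒3∣x-y x y z 3∤x 3∤y 3∤z 3∣x+y+z
  with 3∤x⇒3∤y⇒3∣x-y⊎3∣x+y {x} {y} (3∤x ∘ ∣⇒∣ᵤ) (3∤y ∘ ∣⇒∣ᵤ)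
... | inj₁ 3∣x-y = ∣⇒∣ᵤ 3∣x-y
... | inj₂ 3∣x+y = ⊥-elim (3∤z (∣⇒∣ᵤ (∣m+n∣m⇒∣n (∣ᵤ⇒∣ {i = x + y + z} 3∣x+y+z) 3∣x+y)))

module _ (a b c : ℤ) where

  abcTuple-1+3k : ∀ k → abcTuple a b c (suc (k ℕ.* 3)) ≡ a
  abcTuple-1+3k zero    = refl
  abcTuple-1+3k (suc k) = abcTuple-1+3k k

  abcTuple-2+3k : ∀ k → abcTuple a b c (suc (suc (k ℕ.* 3))) ≡ b
  abcTuple-2+3k zero    = refl
  abcTuple-2+3k (suc k) = abcTuple-2+3k k

  abcTuple-3+3k : ∀ k → abcTuple a b c (suc (suc (suc (k ℕ.* 3)))) ≡ c
  abcTuple-3+3k zero    = refl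
  abcTuple-3+3k (suc k) = abcTuple-3+3k k

  psum-abcTuple : ∀ k → psum (abcTuple a b c) (k ℕ.* 3) ≡ + k * (a + b + c)
  psum-abcTuple zero    = refl
  psum-abcTuple (suc k)
    rewrite psum-abcTuple k | abcTuple-1+3k k | abcTuple-2+3k k | abcTuple-3+3k k =
    one-more-period (+ k)
    where
    one-more-period : ∀ j → j * (a + b + c) + a + b + c ≡ (+ 1 + j) * (a + b + c)
    one-more-period j = solve (j ∷ a ∷ b ∷ c ∷ [])

  3m∣psum⇒3∣a+b+c : ∀ m .{{_ : NonZero m}} →
    + (3 ℕ.* m) ∣ psum (abcTuple a b c) (3 ℕ.* m) → + 3 ∣ a + b + c
  3m∣psum⇒3∣a+b+c m = *-cancelˡ-∣ (+ m) ∘ subst₂ _∣_ 3m≡m*3 psum≡m*sum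
    where
    3m≡m*3 : + (3 ℕ.* m) ≡ + m * + 3
    3m≡m*3 = trans (cong +_ (ℕ.*-comm 3 m)) (pos-* m 3)
    psum≡m*sum : psum (abcTuple a b c) (3 ℕ.* m) ≡ + m * (a + b + c)
    psum≡m*sum = trans (cong (psum (abcTuple a b c)) (ℕ.*-comm 3 m)) (psum-abcTuple m)

∣x+y+z⇒∣y+z+x : ∀ k x y z → k ∣ x + y + z → k ∣ y + z + x
∣x+y+z⇒∣y+z+x k x y z = subst (k ∣_) rotation
  where
  rotation : x + y + z ≡ y + z + x
  rotation = solve (x ∷ y ∷ z ∷ [])

lemma8 : (m : ℕ) → 2 < m → (a b c : ℤ) →
    ¬ (+ 3 ∣ a) → ¬ (+ 3 ∣ b) → ¬ (+ 3 ∣ c) →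
    (¬ (+ 3 ∣ (a - b)) ⊎ ¬ (+ 3 ∣ (b - c)) ⊎ ¬ (+ 3 ∣ (c - a))) →
    ¬ RepresentsCircular m (abcTuple a b c)
lemma8 m 2<m a b c 3∤a 3∤b 3∤c unequal ((_ , _ , closes) , _) =
  [ _$ 3∣x+y+z⇒3∣x-y a b c 3∤a 3∤b 3∤c 3∣a+b+c
  , [ _$ 3∣x+y+z⇒3∣x-y b c a 3∤b 3∤c 3∤a 3∣b+c+a
    , _$ 3∣x+y+z⇒3∣x-y c a b 3∤c 3∤a 3∤b (∣x+y+z⇒∣y+z+x (+ 3) b c a 3∣b+c+a)
    ] ] unequal
  where
  3∣a+b+c : + 3 ∣ a + b + c
  3∣a+b+c = 3m∣psum⇒3∣a+b+c a b c m {{>-nonZero (ℕ.<-trans ℕ.z<s 2<m)}} closes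
  3∣b+c+a : + 3 ∣ b + c + a
  3∣b+c+a = ∣x+y+z⇒∣y+z+x (+ 3) a b c 3∣a+b+c
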